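{- Let $G$ be a cycle digraph with $n\ge2$ vertices. If $n$ is odd, then $G$ has no skew-symmetry. If $n$ is even, then $G$ has exactly $n/2$ skew-symmetries $\sigma$, and for each of them the clause-set $F_{(G,\sigma)}$ is isomorphic to $\mathrm{U}^2_{n/2}$; in particular each such $\sigma$ has a unit, i.e., there is a vertex $v$ with $(v,\sigma(v))\in E(G)$.
   Context: A digraph has a finite vertex set and arcs $(a,b)$ with $a\ne b$, no parallel arcs. A cycle digraph is a strongly connected digraph in which every vertex has in-degree 1 and out-degree 1. A skew-symmetry of a digraph $G$ is a bijection $\sigma:V(G)\to V(G)$ with $\sigma(\sigma(v))=v$ and $\sigma(v)\ne v$ for all $v$, such that $(a,b)\in E(G)$ implies $(\sigma(b),\sigma(a))\in E(G)$. Given a skew-symmetry $\sigma$, regard the vertices as literals with $\sigma$ as complementation ($\overline v:=\sigma(v)$); the associated clause-set $F_{(G,\sigma)}$ contains, for each arc $(a,b)$, the clause $\{\sigma(a),b\}$ (which is the unit-clause $\{b\}$ when $b=\sigma(a)$). Clause-sets $F,G$ are isomorphic if a complement-preserving bijection of literals maps $F$ onto $G$. For $m\ge1$, $\mathrm{U}^2_m$ is the clause-set over variables $1,\dots,m$ (with $\overline v=-v$) consisting of $\{ -1,2\},\{ -2,3\},\dots,\{ -(m-1),m\},\{1\},\{ -m\}$. -}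

module Defs where

open import Data.Nat using (ℕ; zero; suc)
open import Data.Fin using (Fin; toℕ)
open import Data.Bool using (Bool; true; false; not)
open import Data.Product using (Σ; ∃; ∃-syntax; _×_; _,_)
open import Data.Sum using (_⊎_)
open import Relation.Binary.PropositionalEquality using (_≡_; _≢_)
open import Relation.Binary.Construct.Closure.ReflexiveTransitive using (Star)
open import Function.Bundles using (_⇔_; _↔_; Inverse)
open import Level using (Level)

-- A digraph on the finite vertex set Fin n, given by its arc relation
-- (Bool-valued: at most one arc from a to b, i.e. no parallel arcs),
-- with no loops.
record Digraph (n : ℕ) : Set where
  field
    arc     : Fin n → Fin n → Bool
    noLoops : ∀ a → arc a a ≡ false
open Digraph public

Arc : ∀ {n} → Digraph n → Fin n → Fin n → Set
Arc G a b = arc G a b ≡ true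

ExactlyOne : ∀ {n} → (Fin n → Set) → Set
ExactlyOne P = ∃[ x ] (P x × (∀ y → P y → y ≡ x))

StronglyConnected : ∀ {n} → Digraph n → Set
StronglyConnected G = ∀ a b → Star (Arc G) a b

InDegreeOne : ∀ {n} → Digraph n → Fin n → Set
InDegreeOne G v = ExactlyOne (λ a → Arc G a v)

OutDegreeOne : ∀ {n} → Digraph n → Fin n → Set
OutDegreeOne G v = ExactlyOne (λ b → Arc G v b)

IsCycleDigraph : ∀ {n} → Digraph n → Set
IsCycleDigraph G =
  StronglyConnected G × (∀ v → InDegreeOne G v) × (∀ v → OutDegreeOne G v)

IsSkewSymmetry : ∀ {n} → Digraph n → (Fin n → Fin n) → Set
IsSkewSymmetry G σ =
  (∀ v → σ (σ v) ≡ v) × (∀ v → σ v ≢ v) × (∀ a b → Arc G a b → Arc G (σ b) (σ a))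

-- Exactly k functions Fin n → Fin n satisfy P, counted up to pointwise
-- equality (function equality is pointwise in Agda without funext).
_≗f_ : ∀ {n} → (Fin n → Fin n) → (Fin n → Fin n) → Set
f ≗f g = ∀ v → f v ≡ g v

HasExactly : ∀ {n} → ℕ → ((Fin n → Fin n) → Set) → Set
HasExactly {n} k P =
  Σ (Fin k → (Fin n → Fin n)) λ enum →
    (∀ i → P (enum i)) ×
    (∀ i j → enum i ≗f enum j → i ≡ j) ×
    (∀ σ → P σ → ∃[ i ] (enum i ≗f σ))

Clause : Set → Set₁
Clause L = L → Set

ClauseSet : Set → Set₁
ClauseSet L = Clause L → Set

-- C is the set {x, y}  (the unit clause {x} when x ≡ y)
_≐⟦_,_⟧ : ∀ {L : Set} → Clause L → L → L → Set
C ≐⟦ x , y ⟧ = ∀ l → C l ⇔ (l ≡ x ⊎ l ≡ y)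

-- F_(G,σ): literals are vertices, complementation is σ;
-- for each arc (a,b) the clause {σ a, b}.
F[_,_] : ∀ {n} → Digraph n → (Fin n → Fin n) → ClauseSet (Fin n)
F[ G , σ ] C = ∃[ a ] ∃[ b ] (Arc G a b × C ≐⟦ σ a , b ⟧)

-- Literals of U^2_m: variable i : Fin m (standing for i+1) with a sign;
-- (i , true) is the positive literal, (i , false) the negative one.
ULit : ℕ → Set
ULit m = Fin m × Bool

ucompl : ∀ {m} → ULit m → ULit m
ucompl (i , s) = (i , not s)

-- U^2_m = {-1,2},{-2,3},...,{-(m-1),m},{1},{-m}
U2 : (m : ℕ) → ClauseSet (ULit m)
U2 m C =
  (∃[ i ] ∃[ j ] (toℕ j ≡ suc (toℕ i) × C ≐⟦ (i , false) , (j , true) ⟧))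
  ⊎ (∃[ i ] (toℕ i ≡ zero × C ≐⟦ (i , true) , (i , true) ⟧))
  ⊎ (∃[ i ] (suc (toℕ i) ≡ m × C ≐⟦ (i , false) , (i , false) ⟧))

-- Isomorphism of clause-sets: a complement-preserving bijection of
-- literals mapping F onto H (the image of a clause C is C ∘ from).
ClauseSetIso : {L₁ L₂ : Set} → (L₁ → L₁) → (L₂ → L₂) →
               ClauseSet L₁ → ClauseSet L₂ → Set₁
ClauseSetIso {L₁} {L₂} c₁ c₂ F H =
  Σ (L₁ ↔ L₂) λ φ →
    (∀ x → Inverse.to φ (c₁ x) ≡ c₂ (Inverse.to φ x)) ×
    (∀ (C : Clause L₁) → F C ⇔ H (λ l → C (Inverse.from φ l)))

HasUnit : ∀ {n} → Digraph n → (Fin n → Fin n) → Set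
HasUnit G σ = ∃[ v ] Arc G v (σ v)

module Submission where

-- A cycle digraph G on N vertices is the graph of a cyclic permutation s
-- (the successor): every arc is (v , s v), and walkᵗ := sᵗ has period
-- exactly N and is injective on exponents below N.  A skew-symmetry σ maps
-- the arc (v , s v) to (σ (s v) , σ v); so it "reverses" the cycle:
-- s (σ (s v)) ≡ σ v.  Conversely every fixed-point-free reversal is a
-- skew-symmetry, since reversals are automatically involutions.  Measured
-- from a base vertex b, a reversal is the reflection sᵗ b ↦ s^(c-t) b,
-- determined by its offset c (σ b ≡ s^c b), and it fixes sᵗ b exactly when
-- 2t ≡ c (mod N).  Hence for N odd every reversal has a fixed point, while
-- for N = 2K the skew-symmetries are the K reflections with odd offset.
-- An odd offset c = 2j+1 produces a unit vertex v = sʲ b with σ v ≡ s v;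
-- measuring from such a vertex u the literals x_i := s^(i+1) u and their
-- complements ¬x_i := σ x_i (i < K) exhaust the vertices, and the arcs of
-- G become exactly the clauses of U²_K.

open import Defs
open import Data.Nat using (ℕ; zero; suc; _+_; _*_; _∸_; _≤_; _<_; _<?_; z≤n; s≤s; s≤s⁻¹; NonZero)
open import Data.Nat.Properties
open import Data.Nat.DivMod using (_%_; _/_; m≡m%n+[m/n]*n; m%n<n; m∣n⇒o%n%m≡o%m; [m+kn]%n≡m%n)
open import Data.Nat.Divisibility using (_∣_; divides; n∣m⇒m%n≡0; m∣m*n)
open import Data.Nat.Tactic.RingSolver using (solve-∀)
open import Data.Fin using (Fin; toℕ; fromℕ<; inject₁)
  renaming (zero to fzero; suc to fsuc)
open import Data.Fin.Properties using (pigeonhole; toℕ-fromℕ<; toℕ-injective; toℕ<n; toℕ-inject₁)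
import Data.Fin.Properties as Fin
open import Data.Bool using (true; false)
open import Data.Product using (∃-syntax; Σ-syntax; _×_; _,_; proj₁; proj₂)
open import Data.Sum using (_⊎_; inj₁; inj₂)
import Data.Sum as Sum
open import Data.Empty using (⊥-elim)
open import Relation.Nullary using (¬_; yes; no)
open import Relation.Binary.PropositionalEquality
open import Relation.Binary.Definitions using (tri<; tri≈; tri>)
open import Relation.Binary.Construct.Closure.ReflexiveTransitive using (Star; ε; _◅_)
open import Function.Base using (_∘_)
open import Function.Bundles using (_↔_; Inverse; mk⇔; mk↔ₛ′; Equivalence)

even-or-odd : ∀ c → ∃[ h ] (c ≡ 2 * h ⊎ c ≡ suc (2 * h))
even-or-odd zero = 0 , inj₁ refl
even-or-odd (suc c) with even-or-odd c
... | h , inj₁ c≡2h   = h , inj₂ (cong suc c≡2h)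
... | h , inj₂ c≡2h+1 = suc h , inj₁ (cong suc (trans c≡2h+1 (sym (+-suc h (h + 0)))))

gap : ∀ {x y} → x < y → ∃[ d ] y ≡ x + suc d
gap {x} x<y with d , x+1+d≡y ← m≤n⇒∃[o]m+o≡n x<y = d , trans (sym x+1+d≡y) (sym (+-suc x d))

even≢odd-mod : ∀ N .{{_ : NonZero N}} K → N ≡ 2 * K → ∀ t j → (2 * t) % N ≢ suc (2 * j) % N
even≢odd-mod N K N≡2K t j eq = 0≢1 (begin
    0                    ≡⟨ sym (n∣m⇒m%n≡0 (2 * t) 2 (m∣m*n t)) ⟩
    (2 * t) % 2          ≡⟨ sym (m∣n⇒o%n%m≡o%m 2 N (2 * t) 2∣N) ⟩
    (2 * t) % N % 2      ≡⟨ cong (_% 2) eq ⟩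
    suc (2 * j) % N % 2  ≡⟨ m∣n⇒o%n%m≡o%m 2 N (suc (2 * j)) 2∣N ⟩
    suc (2 * j) % 2      ≡⟨ cong (λ m → suc m % 2) (*-comm 2 j) ⟩
    (1 + j * 2) % 2      ≡⟨ [m+kn]%n≡m%n 1 j 2 ⟩
    1                    ∎)
  where
    open ≡-Reasoning
    2∣N : 2 ∣ N
    2∣N = divides K (trans N≡2K (*-comm 2 K))
    0≢1 : 0 ≢ 1
    0≢1 ()

module Walks {A : Set} (s : A → A) where

  walk : ℕ → A → A
  walk zero    v = v
  walk (suc t) v = s (walk t v)

  walk-+ : ∀ t u v → walk t (walk u v) ≡ walk (t + u) v
  walk-+ zero    u v = refl
  walk-+ (suc t) u v = cong s (walk-+ t u v)

  walk-s : ∀ t v → walk t (s v) ≡ s (walk t v)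
  walk-s zero    v = refl
  walk-s (suc t) v = cong s (walk-s t v)

  walk-comm : ∀ t u v → walk t (walk u v) ≡ walk u (walk t v)
  walk-comm t u v = begin
    walk t (walk u v)  ≡⟨ walk-+ t u v ⟩
    walk (t + u) v     ≡⟨ cong (λ m → walk m v) (+-comm t u) ⟩
    walk (u + t) v     ≡⟨ walk-+ u t v ⟨
    walk u (walk t v)  ∎
    where open ≡-Reasoning

  walk-double : ∀ t v → walk t (walk t v) ≡ walk (2 * t) v
  walk-double t v = trans (walk-+ t t v) (cong (λ m → walk (t + m) v) (sym (+-identityʳ t)))

  walk-multiple : ∀ p v → walk p v ≡ v → ∀ q → walk (q * p) v ≡ v
  walk-multiple p v ret zero    = refl
  walk-multiple p v ret (suc q) =
    trans (sym (walk-+ p (q * p) v)) (trans (cong (walk p) (walk-multiple p v ret q)) ret)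

  walk-mod : ∀ p .{{_ : NonZero p}} v → walk p v ≡ v → ∀ t → walk (t % p) v ≡ walk t v
  walk-mod p v ret t = sym (begin
    walk t v                          ≡⟨ cong (λ m → walk m v) (m≡m%n+[m/n]*n t p) ⟩
    walk (t % p + (t / p) * p) v      ≡⟨ walk-+ (t % p) ((t / p) * p) v ⟨
    walk (t % p) (walk ((t / p) * p) v) ≡⟨ cong (walk (t % p)) (walk-multiple p v ret (t / p)) ⟩
    walk (t % p) v                    ∎)
    where open ≡-Reasoning

  walk-injective : (∀ {a b} → s a ≡ s b → a ≡ b) → ∀ t {v w} → walk t v ≡ walk t w → v ≡ w
  walk-injective s-inj zero    eq = eq
  walk-injective s-inj (suc t) eq = walk-injective s-inj t (s-inj eq)

module CyclicPermutation {n : ℕ} (s : Fin (suc n) → Fin (suc n))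
    (s-injective : ∀ {a b} → s a ≡ s b → a ≡ b)
    (reachable : ∀ a b → ∃[ t ] Walks.walk s t a ≡ b) where

  open Walks s

  N : ℕ
  N = suc n

  walk-cancel : ∀ t {v w} → walk t v ≡ walk t w → v ≡ w
  walk-cancel = walk-injective s-injective

  -- Every return time is at least N: modulo a return time p the walks from
  -- v already reach all N vertices, so Fin N injects into Fin p.
  return-time-≥ : ∀ d v → walk (suc d) v ≡ v → N ≤ suc d
  return-time-≥ d v ret = ≮⇒≥ λ short →
    let (i , j , i<j , same) = pigeonhole short residue
    in Fin.<-irrefl (residue-injective same) i<j
    where
      steps : Fin N → ℕ
      steps w = proj₁ (reachable v w)

      residue : Fin N → Fin (suc d)
      residue w = fromℕ< (m%n<n (steps w) (suc d))

      walk-residue : ∀ w → walk (toℕ (residue w)) v ≡ w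
      walk-residue w = trans (cong (λ m → walk m v) (toℕ-fromℕ< (m%n<n (steps w) (suc d))))
        (trans (walk-mod (suc d) v ret (steps w)) (proj₂ (reachable v w)))

      residue-injective : ∀ {w w'} → residue w ≡ residue w' → w ≡ w'
      residue-injective {w} {w'} eq =
        trans (sym (walk-residue w)) (trans (cong (λ i → walk (toℕ i) v) eq) (walk-residue w'))

  repetition⇒return : ∀ v {x y} → x < y → walk x v ≡ walk y v → ∃[ d ] (suc d ≤ y × walk (suc d) v ≡ v)
  repetition⇒return v {x} x<y same with d , y≡x+d+1 ← gap x<y =
    d , subst (suc d ≤_) (sym y≡x+d+1) (m≤n+m (suc d) x) ,
    walk-cancel x (trans (walk-+ x (suc d) v) (trans (cong (λ m → walk m v) (sym y≡x+d+1)) (sym same)))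

  -- Among the N+1 walks of length ≤ N two coincide, so N is a return time.
  period : ∀ v → walk N v ≡ v
  period v =
    let (i , j , i<j , same) = pigeonhole (n<1+n N) (λ (i : Fin (suc N)) → walk (toℕ i) v)
        (d , d+1≤j , ret)    = repetition⇒return v i<j same
        d+1≡N : suc d ≡ N
        d+1≡N = ≤-antisym (≤-trans d+1≤j (s≤s⁻¹ (toℕ<n j))) (return-time-≥ d v ret)
    in subst (λ m → walk m v ≡ v) d+1≡N ret

  no-early-return : ∀ v {x y} → x < y → y < N → walk x v ≢ walk y v
  no-early-return v x<y y<N same with d , d+1≤y , ret ← repetition⇒return v x<y same =
    <⇒≱ y<N (≤-trans (return-time-≥ d v ret) d+1≤y)

  walk-injective-below : ∀ v {x y} → x < N → y < N → walk x v ≡ walk y v → x ≡ y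
  walk-injective-below v {x} {y} x<N y<N same with <-cmp x y
  ... | tri≈ _ x≡y _ = x≡y
  ... | tri< x<y _ _ = ⊥-elim (no-early-return v x<y y<N same)
  ... | tri> _ _ y<x = ⊥-elim (no-early-return v y<x x<N (sym same))

  walk-≡⇒%≡ : ∀ v {x y} → walk x v ≡ walk y v → x % N ≡ y % N
  walk-≡⇒%≡ v {x} {y} same = walk-injective-below v (m%n<n x N) (m%n<n y N)
    (trans (walk-mod N v (period v) x) (trans same (sym (walk-mod N v (period v) y))))

  offset : Fin N → Fin N → ℕ
  offset b v = proj₁ (reachable b v) % N

  offset<N : ∀ b v → offset b v < N
  offset<N b v = m%n<n (proj₁ (reachable b v)) N

  walk-offset : ∀ b v → walk (offset b v) b ≡ v
  walk-offset b v = trans (walk-mod N b (period b) (proj₁ (reachable b v))) (proj₂ (reachable b v))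

  along-cycle : ∀ b (P : Fin N → Set) → (∀ t → P (walk t b)) → ∀ v → P v
  along-cycle b P p v = subst P (walk-offset b v) (p (offset b v))

  Reverses : (Fin N → Fin N) → Set
  Reverses σ = ∀ v → s (σ (s v)) ≡ σ v

  FixedPointFree : (Fin N → Fin N) → Set
  FixedPointFree σ = ∀ v → σ v ≢ v

  reverses-walk : ∀ {σ} → Reverses σ → ∀ t v → walk t (σ (walk t v)) ≡ σ v
  reverses-walk     rev zero    v = refl
  reverses-walk {σ} rev (suc t) v = begin
    s (walk t (σ (s (walk t v))))  ≡⟨ walk-s t (σ (s (walk t v))) ⟨
    walk t (s (σ (s (walk t v))))  ≡⟨ cong (walk t) (rev (walk t v)) ⟩
    walk t (σ (walk t v))          ≡⟨ reverses-walk rev t v ⟩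
    σ v                            ∎
    where open ≡-Reasoning

  reflects⇒reverses : ∀ {σ} b w → (∀ t → walk t (σ (walk t b)) ≡ w) → Reverses σ
  reflects⇒reverses {σ} b w reflects = along-cycle b (λ v → s (σ (s v)) ≡ σ v) λ t →
    walk-cancel t (trans (walk-s t (σ (s (walk t b)))) (trans (reflects (suc t)) (sym (reflects t))))

  -- Every reversal is an involution: if v is t steps after σ v, then
  -- σ (σ v) is t steps after σ v as well.
  reverses-involutive : ∀ {σ} → Reverses σ → ∀ v → σ (σ v) ≡ v
  reverses-involutive {σ} rev v with t , t-steps ← reachable (σ v) v = begin
    σ (σ v)                    ≡⟨ reverses-walk rev t (σ v) ⟨
    walk t (σ (walk t (σ v)))  ≡⟨ cong (λ w → walk t (σ w)) t-steps ⟩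
    walk t (σ v)               ≡⟨ t-steps ⟩
    v                          ∎
    where open ≡-Reasoning

  reverses-unique : ∀ {σ τ} → Reverses σ → Reverses τ → ∀ b → σ b ≡ τ b → ∀ v → σ v ≡ τ v
  reverses-unique {σ} {τ} revσ revτ b σb≡τb = along-cycle b (λ v → σ v ≡ τ v) λ t →
    walk-cancel t (trans (reverses-walk revσ t b) (trans σb≡τb (sym (reverses-walk revτ t b))))

  midpoint⇒fixed : ∀ {σ} → Reverses σ → ∀ b t → walk t (walk t b) ≡ σ b → σ (walk t b) ≡ walk t b
  midpoint⇒fixed rev b t mid = walk-cancel t (trans (reverses-walk rev t b) (sym mid))

  fixed⇒midpoint : ∀ {σ} → Reverses σ → ∀ b t → σ (walk t b) ≡ walk t b → walk t (walk t b) ≡ σ b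
  fixed⇒midpoint rev b t fixed = trans (cong (walk t) (sym fixed)) (reverses-walk rev t b)

  -- The reflection about b with offset c maps sᵗ b to s^(c - t) b.
  reflection : Fin N → ℕ → Fin N → Fin N
  reflection b c v = walk (c + (N ∸ offset b v)) b

  reflection-reflects : ∀ b c t → walk t (reflection b c (walk t b)) ≡ walk c b
  reflection-reflects b c t = begin
    walk t (walk (c + (N ∸ p)) b)  ≡⟨ walk-comm t (c + (N ∸ p)) b ⟩
    walk (c + (N ∸ p)) (walk t b)  ≡⟨ cong (walk (c + (N ∸ p))) (walk-offset b (walk t b)) ⟨
    walk (c + (N ∸ p)) (walk p b)  ≡⟨ walk-+ (c + (N ∸ p)) p b ⟩
    walk (c + (N ∸ p) + p) b       ≡⟨ cong (λ m → walk m b) c+[N∸p]+p≡c+N ⟩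
    walk (c + N) b                 ≡⟨ walk-+ c N b ⟨
    walk c (walk N b)              ≡⟨ cong (walk c) (period b) ⟩
    walk c b                       ∎
    where
      open ≡-Reasoning
      p : ℕ
      p = offset b (walk t b)
      c+[N∸p]+p≡c+N : c + (N ∸ p) + p ≡ c + N
      c+[N∸p]+p≡c+N = trans (+-assoc c (N ∸ p) p) (cong (c +_) (m∸n+n≡m (<⇒≤ (offset<N b (walk t b)))))

  reflection-reverses : ∀ b c → Reverses (reflection b c)
  reflection-reverses b c = reflects⇒reverses b (walk c b) (reflection-reflects b c)

  reflection-base : ∀ b c → reflection b c b ≡ walk c b
  reflection-base b c = reflection-reflects b c 0

  -- On a cycle of odd length N = 2k+1 every reversal σ has a fixed point:
  -- with σ b ≡ s^c b, the vertex sᵗ b for t = c(k+1) satisfies 2t ≡ c.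
  odd-reversal-fixes : ∀ k → N ≡ suc (2 * k) → ∀ {σ} → Reverses σ → ∃[ v ] σ v ≡ v
  odd-reversal-fixes k N≡2k+1 {σ} rev = walk t b , midpoint⇒fixed rev b t (begin
    walk t (walk t b)        ≡⟨ walk-double t b ⟩
    walk (2 * t) b           ≡⟨ cong (λ m → walk m b) 2t≡c+cN ⟩
    walk (c + c * N) b       ≡⟨ walk-+ c (c * N) b ⟨
    walk c (walk (c * N) b)  ≡⟨ cong (walk c) (walk-multiple N b (period b) c) ⟩
    walk c b                 ≡⟨ walk-offset b (σ b) ⟩
    σ b                      ∎)
    where
      open ≡-Reasoning
      b : Fin N
      b = fzero
      c t : ℕ
      c = offset b (σ b)
      t = c * suc k
      2t≡c+cN : 2 * t ≡ c + c * N
      2t≡c+cN = trans (double c k) (cong (λ m → c + c * m) (sym N≡2k+1))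
        where double : ∀ c k → 2 * (c * suc k) ≡ c + c * suc (2 * k)
              double = solve-∀

  module EvenCycle (K : ℕ) (N≡2K : N ≡ 2 * K) where

    N≡K+K : N ≡ K + K
    N≡K+K = trans N≡2K (cong (K +_) (+-identityʳ K))

    odd<N : ∀ {j} → j < K → suc (2 * j) < N
    odd<N {j} j<K = subst (suc (suc (2 * j)) ≤_) (sym N≡2K)
      (subst (_≤ 2 * K) (cong suc (+-suc j (j + 0))) (*-monoʳ-≤ 2 j<K))

    odd<N⁻¹ : ∀ {j} → suc (2 * j) < N → j < K
    odd<N⁻¹ {j} 2j+1<N = *-cancelˡ-< 2 j K (subst (2 * j <_) N≡2K (<-trans (n<1+n (2 * j)) 2j+1<N))

    -- A reversal with odd offset has no fixed point: that would be a
    -- midpoint t with 2t ≡ 2j+1 modulo the even number N.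
    odd-offset⇒fixed-point-free : ∀ {σ} → Reverses σ → ∀ b j → σ b ≡ walk (suc (2 * j)) b → FixedPointFree σ
    odd-offset⇒fixed-point-free {σ} rev b j σb = along-cycle b (λ v → σ v ≢ v) λ t fixed →
      even≢odd-mod N K N≡2K t j (walk-≡⇒%≡ b {2 * t} {suc (2 * j)} (begin
        walk (2 * t) b        ≡⟨ walk-double t b ⟨
        walk t (walk t b)     ≡⟨ fixed⇒midpoint rev b t fixed ⟩
        σ b                   ≡⟨ σb ⟩
        walk (suc (2 * j)) b  ∎))
      where open ≡-Reasoning

    -- A fixed-point-free reversal has odd offset: an even offset 2h would
    -- make sʰ b a fixed point.
    fixed-point-free⇒odd-offset : ∀ {σ} → Reverses σ → FixedPointFree σ → ∀ b →
                                  ∃[ j ] (j < K × σ b ≡ walk (suc (2 * j)) b)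
    fixed-point-free⇒odd-offset {σ} rev fpf b with even-or-odd (offset b (σ b))
    ... | h , inj₁ c≡2h = ⊥-elim (fpf (walk h b) (midpoint⇒fixed rev b h
          (trans (walk-double h b) (trans (cong (λ m → walk m b) (sym c≡2h)) (walk-offset b (σ b))))))
    ... | j , inj₂ c≡2j+1 = j , odd<N⁻¹ (subst (_< N) c≡2j+1 (offset<N b (σ b))) ,
          trans (sym (walk-offset b (σ b))) (cong (λ m → walk m b) c≡2j+1)

    odd : Fin K → ℕ
    odd i = suc (2 * toℕ i)

    odd-reflection : Fin K → Fin N → Fin N
    odd-reflection i = reflection fzero (odd i)

    free-reversals-count : HasExactly K (λ σ → Reverses σ × FixedPointFree σ)
    free-reversals-count = odd-reflection , free , distinct , complete
      where
        free : ∀ i → Reverses (odd-reflection i) × FixedPointFree (odd-reflection i)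
        free i = reflection-reverses fzero (odd i) ,
                 odd-offset⇒fixed-point-free (reflection-reverses fzero (odd i)) fzero (toℕ i) (reflection-base fzero (odd i))

        distinct : ∀ i j → odd-reflection i ≗f odd-reflection j → i ≡ j
        distinct i j same = toℕ-injective (*-cancelˡ-≡ (toℕ i) (toℕ j) 2 (suc-injective
          (walk-injective-below fzero (odd<N (toℕ<n i)) (odd<N (toℕ<n j))
            (trans (sym (reflection-base fzero (odd i))) (trans (same fzero) (reflection-base fzero (odd j)))))))

        complete : ∀ σ → Reverses σ × FixedPointFree σ → ∃[ i ] (odd-reflection i ≗f σ)
        complete σ (rev , fpf) with j , j<K , σ0 ← fixed-point-free⇒odd-offset rev fpf fzero =
          i , reverses-unique (reflection-reverses fzero (odd i)) rev fzero
                (trans (reflection-base fzero (odd i)) (trans (cong (λ m → walk (suc (2 * m)) fzero) (toℕ-fromℕ< j<K)) (sym σ0)))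
          where
            i : Fin K
            i = fromℕ< j<K

    -- With offset 2j+1, the vertex sʲ b is a unit: σ maps it to its successor.
    free-reversal-unit : ∀ {σ} → Reverses σ → FixedPointFree σ → ∃[ u ] σ u ≡ s u
    free-reversal-unit {σ} rev fpf with j , _ , σb ← fixed-point-free⇒odd-offset rev fpf fzero =
      walk j b , walk-cancel j (begin
        walk j (σ (walk j b))  ≡⟨ reverses-walk rev j b ⟩
        σ b                    ≡⟨ σb ⟩
        walk (suc (2 * j)) b   ≡⟨ cong s (walk-double j b) ⟨
        s (walk j (walk j b))  ≡⟨ walk-s j (walk j b) ⟨
        walk j (s (walk j b))  ∎)
      where
        open ≡-Reasoning
        b : Fin N
        b = fzero

    module UnitCoordinates {σ} (rev : Reverses σ) (u : Fin N) (unit : σ u ≡ s u) where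

      pos neg : Fin K → Fin N
      pos i = walk (suc (toℕ i)) u
      neg i = σ (pos i)

      literal : ULit K → Fin N
      literal (i , true)  = pos i
      literal (i , false) = neg i

      σ-neg : ∀ i → σ (neg i) ≡ pos i
      σ-neg i = reverses-involutive rev (pos i)

      literal-compl : ∀ l → σ (literal l) ≡ literal (ucompl l)
      literal-compl (i , true)  = refl
      literal-compl (i , false) = σ-neg i

      walk-neg : ∀ i → walk (toℕ i) (neg i) ≡ u
      walk-neg i = s-injective (trans (reverses-walk rev (suc (toℕ i)) u) unit)

      neg-unique : ∀ i {v} → walk (toℕ i) v ≡ u → neg i ≡ v
      neg-unique i i-steps = walk-cancel (toℕ i) (trans (walk-neg i) (sym i-steps))

      -- The successor in literal coordinates: x_i → x_(i+1) → … → x_(K-1)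
      -- → ¬x_(K-1) → … → ¬x_0 = u → x_0.
      s-pos-next : ∀ {i j} → toℕ j ≡ suc (toℕ i) → s (pos i) ≡ pos j
      s-pos-next j≡i+1 = cong (λ m → walk (suc m) u) (sym j≡i+1)

      s-pos-last : ∀ {i} → suc (toℕ i) ≡ K → s (pos i) ≡ neg i
      s-pos-last {i} i+1≡K = sym (neg-unique i (begin
        walk (toℕ i) (walk (suc (suc (toℕ i))) u)  ≡⟨ walk-+ (toℕ i) (suc (suc (toℕ i))) u ⟩
        walk (toℕ i + suc (suc (toℕ i))) u          ≡⟨ cong (λ m → walk m u) i+[i+2]≡N ⟩
        walk N u                                    ≡⟨ period u ⟩
        u                                           ∎))
        where
          open ≡-Reasoning
          i+[i+2]≡N : toℕ i + suc (suc (toℕ i)) ≡ N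
          i+[i+2]≡N = trans (+-suc (toℕ i) (suc (toℕ i)))
            (trans (cong (λ m → m + m) i+1≡K) (sym N≡K+K))

      s-neg-first : ∀ {i} → toℕ i ≡ 0 → s (neg i) ≡ pos i
      s-neg-first {i} i≡0 =
        trans (cong s (neg-unique i (cong (λ m → walk m u) i≡0))) (cong (λ m → walk (suc m) u) (sym i≡0))

      s-neg-prev : ∀ {i i'} → toℕ i ≡ suc (toℕ i') → s (neg i) ≡ neg i'
      s-neg-prev {i} {i'} i≡i'+1 = sym (neg-unique i'
        (trans (walk-s (toℕ i') (neg i)) (trans (cong (λ m → walk m (neg i)) (sym i≡i'+1)) (walk-neg i))))

      j+i+1<N : ∀ (i j : Fin K) → toℕ j + suc (toℕ i) < N
      j+i+1<N i j = subst (toℕ j + suc (toℕ i) <_) (sym N≡K+K)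
        (+-mono-<-≤ (toℕ<n j) (toℕ<n i))

      pos-injective : ∀ {i j} → pos i ≡ pos j → i ≡ j
      pos-injective {i} {j} same = toℕ-injective (suc-injective
        (walk-injective-below u (i+1<N i) (i+1<N j) same))
        where i+1<N : ∀ i → suc (toℕ i) < N
              i+1<N i = ≤-<-trans (m≤n+m (suc (toℕ i)) (toℕ i)) (j+i+1<N i i)

      -- x_i ≡ ¬x_j would let u return after j + i + 1 < N steps.
      pos≢neg : ∀ i j → pos i ≢ neg j
      pos≢neg i j same = m+1+n≢0 (toℕ j) (walk-injective-below u (j+i+1<N i j) (s≤s z≤n)
        (trans (sym (walk-+ (toℕ j) (suc (toℕ i)) u)) (trans (cong (walk (toℕ j)) same) (walk-neg j))))

      literal-injective : ∀ {l l'} → literal l ≡ literal l' → l ≡ l'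
      literal-injective {i , true}  {j , true}  same = cong (_, true) (pos-injective same)
      literal-injective {i , false} {j , false} same =
        cong (_, false) (pos-injective (trans (sym (σ-neg i)) (trans (cong σ same) (σ-neg j))))
      literal-injective {i , true}  {j , false} same = ⊥-elim (pos≢neg i j same)
      literal-injective {i , false} {j , true}  same = ⊥-elim (pos≢neg j i (sym same))

      walk-steps : ∀ v → walk (suc (offset (s u) v)) u ≡ v
      walk-steps v = trans (sym (walk-s (offset (s u) v) u)) (walk-offset (s u) v)

      -- Every vertex is a literal: write it as s^(q+1) u with q < N; it is
      -- x_q if q < K, and otherwise ¬x_i for i = N - (q+1) < K.
      literal-surjective : ∀ v → ∃[ l ] literal l ≡ v
      literal-surjective v with offset (s u) v <? K
      ... | yes q<K = (fromℕ< q<K , true) ,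
                      trans (cong (λ m → walk (suc m) u) (toℕ-fromℕ< q<K)) (walk-steps v)
      ... | no  q≮K = (fromℕ< i<K , false) , neg-unique (fromℕ< i<K) (begin
            walk (toℕ (fromℕ< i<K)) v          ≡⟨ cong (λ m → walk m v) (toℕ-fromℕ< i<K) ⟩
            walk (N ∸ suc q) v                 ≡⟨ cong (walk (N ∸ suc q)) (walk-steps v) ⟨
            walk (N ∸ suc q) (walk (suc q) u)  ≡⟨ walk-+ (N ∸ suc q) (suc q) u ⟩
            walk (N ∸ suc q + suc q) u         ≡⟨ cong (λ m → walk m u) (m∸n+n≡m q<N) ⟩
            walk N u                           ≡⟨ period u ⟩
            u                                  ∎)
        where
          open ≡-Reasoning
          q : ℕ
          q = offset (s u) v
          q<N : q < N
          q<N = offset<N (s u) v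
          i<K : N ∸ suc q < K
          i<K = subst (N ∸ suc q <_) (trans (cong (_∸ K) N≡K+K) (m+n∸m≡n K K))
            (∸-monoʳ-< (s≤s (≮⇒≥ q≮K)) q<N)

      coordinate : Fin N → ULit K
      coordinate v = proj₁ (literal-surjective v)

      literal-coordinate : ∀ v → literal (coordinate v) ≡ v
      literal-coordinate v = proj₂ (literal-surjective v)

      unit-coordinates : Fin N ↔ ULit K
      unit-coordinates = mk↔ₛ′ coordinate literal
        (λ l → literal-injective (literal-coordinate (literal l))) literal-coordinate

      coordinate-compl : ∀ v → coordinate (σ v) ≡ ucompl (coordinate v)
      coordinate-compl v = literal-injective (begin
        literal (coordinate (σ v))       ≡⟨ literal-coordinate (σ v) ⟩
        σ v                              ≡⟨ cong σ (literal-coordinate v) ⟨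
        σ (literal (coordinate v))       ≡⟨ literal-compl (coordinate v) ⟩
        literal (ucompl (coordinate v))  ∎)
        where open ≡-Reasoning

≐-swap : ∀ {L : Set} {C : Clause L} {x y} → C ≐⟦ x , y ⟧ → C ≐⟦ y , x ⟧
≐-swap C≐xy l = mk⇔ (Sum.swap ∘ Equivalence.to (C≐xy l)) (Equivalence.from (C≐xy l) ∘ Sum.swap)

≐-cong : ∀ {L : Set} {C : Clause L} {x x' y y'} → x ≡ x' → y ≡ y' → C ≐⟦ x , y ⟧ → C ≐⟦ x' , y' ⟧
≐-cong refl refl C≐xy = C≐xy

module _ {A B : Set} (φ : A ↔ B) where
  open Inverse φ

  from-injective : ∀ {x y} → from x ≡ from y → x ≡ y
  from-injective {x} {y} same = trans (sym (strictlyInverseˡ x)) (trans (cong to same) (strictlyInverseˡ y))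

  ≐-rename : ∀ {C : Clause A} {x y} → C ≐⟦ from x , from y ⟧ → (λ l → C (from l)) ≐⟦ x , y ⟧
  ≐-rename C≐ l = mk⇔
    (λ c → Sum.map from-injective from-injective (Equivalence.to (C≐ (from l)) c))
    (λ l≡ → Equivalence.from (C≐ (from l)) (Sum.map (cong from) (cong from) l≡))

  ≐-unrename : ∀ {C : Clause A} {x y} → (λ l → C (from l)) ≐⟦ x , y ⟧ → C ≐⟦ from x , from y ⟧
  ≐-unrename {C} {x} {y} C≐ a = mk⇔
    (λ c → Sum.map (back x) (back y) (Equivalence.to (C≐ (to a)) (subst C (sym (strictlyInverseʳ a)) c)))
    λ { (inj₁ refl) → Equivalence.from (C≐ x) (inj₁ refl)
      ; (inj₂ refl) → Equivalence.from (C≐ y) (inj₂ refl) }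
    where
      back : ∀ z → to a ≡ z → a ≡ from z
      back z to-a≡z = trans (sym (strictlyInverseʳ a)) (cong from to-a≡z)

HasExactly-cong : ∀ {n k} {P Q : (Fin n → Fin n) → Set} →
                  (∀ σ → P σ → Q σ) → (∀ σ → Q σ → P σ) → HasExactly k P → HasExactly k Q
HasExactly-cong P⇒Q Q⇒P (enum , valid , distinct , complete) =
  enum , (λ i → P⇒Q _ (valid i)) , distinct , λ σ q → complete σ (Q⇒P σ q)

next-or-last : ∀ {K} (i : Fin K) → (Σ[ j ∈ Fin K ] toℕ j ≡ suc (toℕ i)) ⊎ suc (toℕ i) ≡ K
next-or-last {K} i with suc (toℕ i) <? K
... | yes i+1<K = inj₁ (fromℕ< i+1<K , toℕ-fromℕ< i+1<K)
... | no  i+1≮K = inj₂ (≤-antisym (toℕ<n i) (≮⇒≥ i+1≮K))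

zero-or-previous : ∀ {K} (i : Fin K) → toℕ i ≡ 0 ⊎ Σ[ i' ∈ Fin K ] toℕ i ≡ suc (toℕ i')
zero-or-previous fzero    = inj₁ refl
zero-or-previous (fsuc i) = inj₂ (inject₁ i , cong suc (sym (toℕ-inject₁ i)))

module CycleDigraph {n : ℕ} (G : Digraph (suc n)) (cyc : IsCycleDigraph G) where

  successor : Fin (suc n) → Fin (suc n)
  successor v = proj₁ (proj₂ (proj₂ cyc) v)

  arc-successor : ∀ v → Arc G v (successor v)
  arc-successor v = proj₁ (proj₂ (proj₂ (proj₂ cyc) v))

  arc⇒successor : ∀ {a b} → Arc G a b → b ≡ successor a
  arc⇒successor {a} ab = proj₂ (proj₂ (proj₂ (proj₂ cyc) a)) _ ab

  -- Two vertices with the same successor are both its unique in-neighbour.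
  successor-injective : ∀ {a a'} → successor a ≡ successor a' → a ≡ a'
  successor-injective {a} {a'} same =
    trans (in-unique a (arc-successor a)) (sym (in-unique a' (subst (Arc G a') (sym same) (arc-successor a'))))
    where
      in-unique : ∀ x → Arc G x (successor a) → x ≡ proj₁ (proj₁ (proj₂ cyc) (successor a))
      in-unique = proj₂ (proj₂ (proj₁ (proj₂ cyc) (successor a)))

  open Walks successor

  path⇒walk : ∀ {a b} → Star (Arc G) a b → ∃[ t ] walk t a ≡ b
  path⇒walk ε = 0 , refl
  path⇒walk {a} (ax ◅ path) with t , t-steps ← path⇒walk path =
    suc t , trans (sym (walk-s t a)) (trans (cong (walk t) (sym (arc⇒successor ax))) t-steps)

  open CyclicPermutation successor successor-injective (λ a b → path⇒walk (proj₁ cyc a b))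

  skew⇒reverses : ∀ {σ} → IsSkewSymmetry G σ → Reverses σ
  skew⇒reverses (_ , _ , skew-arc) v = sym (arc⇒successor (skew-arc v (successor v) (arc-successor v)))

  free-reversal⇒skew : ∀ {σ} → Reverses σ → FixedPointFree σ → IsSkewSymmetry G σ
  free-reversal⇒skew {σ} rev fpf = reverses-involutive rev , fpf , λ a b ab →
    subst (λ x → Arc G (σ x) (σ a)) (sym (arc⇒successor ab))
      (subst (Arc G (σ (successor a))) (rev a) (arc-successor (σ (successor a))))

  no-skew-symmetry : ∀ k → N ≡ suc (2 * k) → ¬ (∃[ σ ] IsSkewSymmetry G σ)
  no-skew-symmetry k N≡2k+1 (σ , skew@(_ , fpf , _)) =
    let (v , fixed) = odd-reversal-fixes k N≡2k+1 (skew⇒reverses skew) in fpf v fixed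

  module _ (k : ℕ) (N≡2k : N ≡ 2 * k) where
    open EvenCycle k N≡2k

    skew-symmetry-count : HasExactly k (IsSkewSymmetry G)
    skew-symmetry-count = HasExactly-cong
      (λ σ (rev , fpf) → free-reversal⇒skew rev fpf)
      (λ σ skew → skew⇒reverses skew , proj₁ (proj₂ skew))
      free-reversals-count

    skew-unit : ∀ {σ} → IsSkewSymmetry G σ → ∃[ u ] σ u ≡ successor u
    skew-unit skew = free-reversal-unit (skew⇒reverses skew) (proj₁ (proj₂ skew))

    module ClauseCoordinates {σ} (skew : IsSkewSymmetry G σ) (u : Fin N) (unit : σ u ≡ successor u) where
      open UnitCoordinates (skew⇒reverses skew) u unit

      arc-clause : ∀ {C} a → C ≐⟦ σ a , successor a ⟧ → F[ G , σ ] C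
      arc-clause a C≐ = a , successor a , arc-successor a , C≐

      literal-clause : ∀ {C} l → C ≐⟦ σ (literal l) , successor (literal l) ⟧ → U2 k (λ l' → C (literal l'))
      literal-clause (i , true) C≐ with next-or-last i
      ... | inj₁ (j , j≡i+1) = inj₁ (i , j , j≡i+1 , ≐-rename unit-coordinates (≐-cong refl (s-pos-next j≡i+1) C≐))
      ... | inj₂ i+1≡k = inj₂ (inj₂ (i , i+1≡k , ≐-rename unit-coordinates (≐-cong refl (s-pos-last i+1≡k) C≐)))
      literal-clause (i , false) C≐ with zero-or-previous i
      ... | inj₁ i≡0 = inj₂ (inj₁ (i , i≡0 , ≐-rename unit-coordinates (≐-cong (σ-neg i) (s-neg-first i≡0) C≐)))
      ... | inj₂ (i' , i≡i'+1) =
        inj₁ (i' , i , i≡i'+1 , ≐-rename unit-coordinates (≐-swap (≐-cong (σ-neg i) (s-neg-prev i≡i'+1) C≐)))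

      F⇒U2 : ∀ C → F[ G , σ ] C → U2 k (λ l → C (literal l))
      F⇒U2 C (a , b , ab , C≐) = literal-clause (coordinate a) (≐-cong
        (cong σ (sym (literal-coordinate a)))
        (trans (arc⇒successor ab) (cong successor (sym (literal-coordinate a))))
        C≐)

      U2⇒F : ∀ C → U2 k (λ l → C (literal l)) → F[ G , σ ] C
      U2⇒F C (inj₁ (i , j , j≡i+1 , C≐)) =
        arc-clause (pos i) (≐-cong refl (sym (s-pos-next j≡i+1)) (≐-unrename unit-coordinates C≐))
      U2⇒F C (inj₂ (inj₁ (i , i≡0 , C≐))) =
        arc-clause (neg i) (≐-cong (sym (σ-neg i)) (sym (s-neg-first i≡0)) (≐-unrename unit-coordinates C≐))
      U2⇒F C (inj₂ (inj₂ (i , i+1≡k , C≐))) =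
        arc-clause (pos i) (≐-cong refl (sym (s-pos-last i+1≡k)) (≐-unrename unit-coordinates C≐))

      clause-set-iso : ClauseSetIso σ ucompl F[ G , σ ] (U2 k)
      clause-set-iso = unit-coordinates , coordinate-compl , λ C → mk⇔ (F⇒U2 C) (U2⇒F C)

    skew-clause-set-iso : ∀ {σ} → IsSkewSymmetry G σ → ClauseSetIso σ ucompl F[ G , σ ] (U2 k)
    skew-clause-set-iso skew with u , unit ← skew-unit skew = ClauseCoordinates.clause-set-iso skew u unit

    skew-has-unit : ∀ {σ} → IsSkewSymmetry G σ → HasUnit G σ
    skew-has-unit skew with u , unit ← skew-unit skew = u , subst (Arc G u) (sym unit) (arc-successor u)

lemma7p5 : (n : ℕ) → 2 ≤ n → (G : Digraph n) → IsCycleDigraph G →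
    ((k : ℕ) → n ≡ suc (2 * k) → ¬ (∃[ σ ] IsSkewSymmetry G σ))
    × ((k : ℕ) → n ≡ 2 * k →
        HasExactly k (IsSkewSymmetry G)
        × ((σ : Fin n → Fin n) → IsSkewSymmetry G σ →
            ClauseSetIso σ ucompl F[ G , σ ] (U2 k) × HasUnit G σ))
lemma7p5 (suc n) _ G cyc =
  no-skew-symmetry ,
  λ k N≡2k → skew-symmetry-count k N≡2k ,
             λ σ skew → skew-clause-set-iso k N≡2k skew , skew-has-unit k N≡2k skew
  where open CycleDigraph G cyc
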